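{- Let $k,\ell,i$ be positive integers. Let $G$ be a $\{K^{*}_{k},S^{*}_{\ell}\}$-free graph and let $a$ be a vertex of $G$. Then for every independent set $X\subseteq N^{i}_{G}(a)$, there exists $U\subseteq N^{i-1}_{G}(a)$ with $|U|\leq g_{k,\ell}(i)$ such that $X\subseteq N_G[U]$ (i.e., $U$ dominates $X$).
   Context: All graphs are finite, simple and undirected. For a vertex $x$, $N_G[x]$ is the closed neighborhood of $x$, and for $U\subseteq V(G)$, $N_G[U]=\bigcup_{u\in U}N_G[u]$. For a non-negative integer $i$, $N^{i}_{G}(a)$ is the set of vertices at distance exactly $i$ from $a$ in $G$ (so $N^0_G(a)=\{a\}$). A graph is $\mathcal{H}$-free if it contains no member of $\mathcal{H}$ as an induced subgraph. For $n\geq1$, $K^{*}_{n}$ is the graph with vertex set $\{x_1,\dots,x_n,y_1,\dots,y_n\}$ and edge set $\{x_ix_j:1\leq i<j\leq n\}\cup\{x_iy_i:1\leq i\leq n\}$; $S^{*}_{n}$ is the graph with vertex set $\{x\}\cup\{y_1,\dots,y_n\}\cup\{z_1,\dots,z_n\}$ and edge set $\{xy_i\}\cup\{y_iz_i\}$ ($1\leq i\leq n$). $R(s,t)$ denotes the Ramsey number. For positive integers $k,\ell,i$, define recursively $g_{k,\ell}(1)=1$ and $g_{k,\ell}(i)=R\bigl(k,(\ell-1)g_{k,\ell}(i-1)+1\bigr)-1$ for $i\geq 2$. -}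

module Defs where

open import Data.Nat using (ℕ; zero; suc; _+_; _*_; _∸_; _≤_; _<_)
open import Data.Fin using (Fin)
open import Data.Fin.Subset using (Subset; _∈_; ∣_∣)
open import Data.Sum using (_⊎_; inj₁; inj₂)
open import Data.Product using (Σ; _×_; ∃; ∃-syntax)
open import Data.Unit using (⊤)
open import Data.Empty using (⊥)
open import Relation.Nullary using (¬_)
open import Relation.Binary using (Decidable)
open import Relation.Binary.PropositionalEquality using (_≡_; _≢_)
open import Function.Definitions using (Injective)

record Graph (n : ℕ) : Set₁ where
  field
    Adj    : Fin n → Fin n → Set
    sym    : ∀ {u v} → Adj u v → Adj v u
    irrefl : ∀ {u} → ¬ Adj u u
    adj?   : Decidable Adj
open Graph public

ContainsInduced : ∀ {n} → Graph n → (V : Set) → (V → V → Set) → Set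
ContainsInduced {n} G V P =
  Σ (V → Fin n) λ f → Injective _≡_ _≡_ f ×
    (∀ u v → (Adj G (f u) (f v) → P u v) × (P u v → Adj G (f u) (f v)))

-- K*_k : vertices x_i = inj₁ i, y_i = inj₂ i.
KStarAdj : (k : ℕ) → Fin k ⊎ Fin k → Fin k ⊎ Fin k → Set
KStarAdj k (inj₁ i) (inj₁ j) = i ≢ j
KStarAdj k (inj₁ i) (inj₂ j) = i ≡ j
KStarAdj k (inj₂ i) (inj₁ j) = i ≡ j
KStarAdj k (inj₂ i) (inj₂ j) = ⊥

-- S*_ℓ : vertices x = inj₁ _, y_i = inj₂ (inj₁ i), z_i = inj₂ (inj₂ i).
SStarAdj : (ℓ : ℕ) → ⊤ ⊎ (Fin ℓ ⊎ Fin ℓ) → ⊤ ⊎ (Fin ℓ ⊎ Fin ℓ) → Set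
SStarAdj ℓ (inj₁ _) (inj₂ (inj₁ _)) = ⊤
SStarAdj ℓ (inj₂ (inj₁ _)) (inj₁ _) = ⊤
SStarAdj ℓ (inj₂ (inj₁ i)) (inj₂ (inj₂ j)) = i ≡ j
SStarAdj ℓ (inj₂ (inj₂ i)) (inj₂ (inj₁ j)) = i ≡ j
SStarAdj ℓ _ _ = ⊥

KStarFree : ∀ {n} → Graph n → ℕ → Set
KStarFree G k = ¬ ContainsInduced G (Fin k ⊎ Fin k) (KStarAdj k)

SStarFree : ∀ {n} → Graph n → ℕ → Set
SStarFree G ℓ = ¬ ContainsInduced G (⊤ ⊎ (Fin ℓ ⊎ Fin ℓ)) (SStarAdj ℓ)

data Walk {n} (G : Graph n) (a : Fin n) : Fin n → ℕ → Set where
  here : Walk G a a 0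
  step : ∀ {v w m} → Walk G a v m → Adj G v w → Walk G a w (suc m)

AtDist : ∀ {n} → Graph n → Fin n → Fin n → ℕ → Set
AtDist G a v i = Walk G a v i × (∀ j → j < i → ¬ Walk G a v j)

IndependentSet : ∀ {n} → Graph n → Subset n → Set
IndependentSet G X = ∀ u v → u ∈ X → v ∈ X → ¬ Adj G u v

Dominates : ∀ {n} → Graph n → Subset n → Subset n → Set
Dominates G U X = ∀ x → x ∈ X → ∃[ u ] (u ∈ U × (u ≡ x ⊎ Adj G u x))

HasClique : ∀ {n} → Graph n → ℕ → Set
HasClique {n} G s = Σ (Fin s → Fin n) λ f → Injective _≡_ _≡_ f ×
  (∀ i j → i ≢ j → Adj G (f i) (f j))

HasIndep : ∀ {n} → Graph n → ℕ → Set
HasIndep {n} G t = Σ (Fin t → Fin n) λ f → Injective _≡_ _≡_ f ×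
  (∀ i j → i ≢ j → ¬ Adj G (f i) (f j))

RamseyProp : ℕ → ℕ → ℕ → Set₁
RamseyProp s t N = (G : Graph N) → HasClique G s ⊎ HasIndep G t

IsRamsey : ℕ → ℕ → ℕ → Set₁
IsRamsey s t N = RamseyProp s t N × (∀ M → M < N → ¬ RamseyProp s t M)

data IsG (k ℓ : ℕ) : ℕ → ℕ → Set₁ where
  g-one  : IsG k ℓ 1 1
  g-step : ∀ {i m r} → IsG k ℓ i m → IsRamsey k ((ℓ ∸ 1) * m + 1) r →
           IsG k ℓ (suc i) (r ∸ 1)

-- Choose U ⊆ N^{i-1}(a) as a minimal dominating set of X; minimality gives every
-- u ∈ U a private neighbour in X, so U with these neighbours spans an induced matching. If
-- |U| ≥ R(k, (ℓ-1) g(i-1) + 1), Ramsey's theorem in G[U] yields either a k-clique, which together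
-- with its private neighbours is an induced K*_k, or an independent set of (ℓ-1) g(i-1) + 1
-- vertices of N^{i-1}(a). By induction the latter is dominated by at most g(i-1) vertices of
-- N^{i-2}(a), so by pigeonhole one of them is adjacent to ℓ of its members; being at distance
-- i-2 from a it misses their private neighbours, and we obtain an induced S*_ℓ.

module Submission where

open import Defs
open import Data.Nat using (ℕ; _≤_; _∸_)
open import Data.Fin using (Fin)
open import Data.Fin.Subset using (Subset; _∈_; ∣_∣)
open import Data.Product using (_×_; ∃-syntax)

open import Data.Bool using (if_then_else_)
open import Data.Empty using (⊥-elim)
open import Data.Fin using (zero; suc; inject≤; punchOut; _≟_)
open import Data.Fin.Properties
  using (any?; all?; ¬∀⟶∃¬; suc-injective; inject≤-injective; punchIn-punchOut)
open import Data.Fin.Subset using (_⊂_; _⊆_; _-_; ⁅_⁆; inside; outside)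
open import Data.Fin.Subset.Properties
  using (_∈?_; x∈p⇒p-x⊂p; p─q⊆p; x∈p∧x≢y⇒x∈p-y; ∣⁅x⁆∣≡1; x∈⁅x⁆; x∈⁅y⁆⇒x≡y)
open import Data.Fin.Subset.Induction using (⊂-wellFounded; Acc; acc)
open import Data.Nat using (zero; suc; _+_; _*_; _<_; s≤s; z<s; _≤?_)
import Data.Nat.Properties as ℕ
open import Data.Product using (Σ; _,_; proj₁; proj₂)
open import Data.Sum using (_⊎_; inj₁; inj₂; [_,_]′)
open import Data.Unit using (⊤; tt)
open import Data.Vec using ([]; _∷_; here; there)
open import Function using (_∘_)
open import Function.Definitions using (Injective)
open import Relation.Nullary using (¬_; Dec; yes; no; does; ¬?)
open import Relation.Nullary.Decidable using (_×-dec_; _⊎-dec_; _→-dec_)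
open import Relation.Binary using (tri<; tri≈; tri>)
open import Relation.Binary.PropositionalEquality as ≡ using (_≡_; _≢_; refl; subst; cong)

private
  variable
    n r s t : ℕ

enumerate : (p : Subset n) → Fin ∣ p ∣ → Fin n
enumerate (inside  ∷ p) zero    = zero
enumerate (inside  ∷ p) (suc j) = suc (enumerate p j)
enumerate (outside ∷ p) j       = suc (enumerate p j)

enumerate-∈ : (p : Subset n) (j : Fin ∣ p ∣) → enumerate p j ∈ p
enumerate-∈ (inside  ∷ p) zero    = here
enumerate-∈ (inside  ∷ p) (suc j) = there (enumerate-∈ p j)
enumerate-∈ (outside ∷ p) j       = there (enumerate-∈ p j)

enumerate-injective : (p : Subset n) → Injective _≡_ _≡_ (enumerate p)
enumerate-injective (inside  ∷ p) {zero}  {zero}  _  = refl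
enumerate-injective (inside  ∷ p) {suc i} {suc j} eq =
  cong suc (enumerate-injective p (suc-injective eq))
enumerate-injective (outside ∷ p) eq = enumerate-injective p (suc-injective eq)

enumerate-surjective : (p : Subset n) {x : Fin n} → x ∈ p → ∃[ j ] enumerate p j ≡ x
enumerate-surjective (inside ∷ p) here = zero , refl
enumerate-surjective (inside ∷ p) (there x∈p) with enumerate-surjective p x∈p
... | j , eq = suc j , cong suc eq
enumerate-surjective (outside ∷ p) (there x∈p) with enumerate-surjective p x∈p
... | j , eq = j , cong suc eq

embed : (p : Subset n) → s ≤ ∣ p ∣ → Fin s → Fin n
embed p s≤∣p∣ j = enumerate p (inject≤ j s≤∣p∣)

embed-∈ : (p : Subset n) (s≤∣p∣ : s ≤ ∣ p ∣) (j : Fin s) → embed p s≤∣p∣ j ∈ p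
embed-∈ p s≤∣p∣ j = enumerate-∈ p (inject≤ j s≤∣p∣)

embed-injective : (p : Subset n) (s≤∣p∣ : s ≤ ∣ p ∣) → Injective _≡_ _≡_ (embed p s≤∣p∣)
embed-injective p s≤∣p∣ {i} {j} eq =
  inject≤-injective s≤∣p∣ s≤∣p∣ i j (enumerate-injective p eq)

filter : {P : Fin n → Set} → (∀ x → Dec (P x)) → Subset n
filter {zero}  P? = []
filter {suc n} P? = (if does (P? zero) then inside else outside) ∷ filter (P? ∘ suc)

∈-filter⁺ : {P : Fin n → Set} (P? : ∀ x → Dec (P x)) {x : Fin n} → P x → x ∈ filter P?
∈-filter⁺ P? {zero} px with P? zero
... | yes _  = here
... | no ¬px = ⊥-elim (¬px px)
∈-filter⁺ P? {suc x} px = there (∈-filter⁺ (P? ∘ suc) px)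

∈-filter⁻ : {P : Fin n → Set} (P? : ∀ x → Dec (P x)) {x : Fin n} → x ∈ filter P? → P x
∈-filter⁻ P? {zero} x∈ with P? zero | x∈
... | yes px | _ = px
∈-filter⁻ P? {suc x} (there x∈) = ∈-filter⁻ (P? ∘ suc) x∈

∣filter∣+∣filter-¬∣≡n : {P : Fin n → Set} (P? : ∀ x → Dec (P x)) →
                        ∣ filter P? ∣ + ∣ filter (¬? ∘ P?) ∣ ≡ n
∣filter∣+∣filter-¬∣≡n {zero}  P? = refl
∣filter∣+∣filter-¬∣≡n {suc n} P? with P? zero
... | yes _ = cong suc (∣filter∣+∣filter-¬∣≡n (P? ∘ suc))
... | no  _ = ≡.trans (ℕ.+-suc _ _) (cong suc (∣filter∣+∣filter-¬∣≡n (P? ∘ suc)))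

image : (Fin t → Fin n) → Subset n
image f = filter (λ y → any? (λ j → f j ≟ y))

∈-image : (f : Fin t → Fin n) (j : Fin t) → f j ∈ image f
∈-image f j = ∈-filter⁺ (λ y → any? (λ j → f j ≟ y)) (j , refl)

∈-image⁻ : (f : Fin t → Fin n) {y : Fin n} → y ∈ image f → ∃[ j ] f j ≡ y
∈-image⁻ f = ∈-filter⁻ (λ y → any? (λ j → f j ≟ y))

pigeonhole : ∀ L {q t} (c : Fin t → Fin q) → L * q < t →
  ∃[ y ] Σ (Fin (suc L) → Fin t) λ h → Injective _≡_ _≡_ h × (∀ j → c (h j) ≡ y)
pigeonhole L {zero} {suc t} c _ with () ← c zero
pigeonhole L {suc q} {t} c L*q<t = split (suc L ≤? ∣ Z ∣)
  where
  Z? : ∀ j → Dec (c j ≡ zero)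
  Z? j = c j ≟ zero

  Z Z′ : Subset t
  Z  = filter Z?
  Z′ = filter (¬? ∘ Z?)

  zero≢ : ∀ j → zero ≢ c (enumerate Z′ j)
  zero≢ j = ≡.≢-sym (∈-filter⁻ (¬? ∘ Z?) (enumerate-∈ Z′ j))

  L*q<∣Z′∣ : ∣ Z ∣ ≤ L → L * q < ∣ Z′ ∣
  L*q<∣Z′∣ ∣Z∣≤L = ℕ.+-cancelˡ-< L (L * q) ∣ Z′ ∣ (begin-strict
    L + L * q          ≡⟨ ℕ.*-suc L q ⟨
    L * suc q          <⟨ L*q<t ⟩
    t                  ≡⟨ ∣filter∣+∣filter-¬∣≡n Z? ⟨
    ∣ Z ∣ + ∣ Z′ ∣     ≤⟨ ℕ.+-monoˡ-≤ ∣ Z′ ∣ ∣Z∣≤L ⟩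
    L + ∣ Z′ ∣         ∎)
    where open ℕ.≤-Reasoning

  split : Dec (suc L ≤ ∣ Z ∣) →
    ∃[ y ] Σ (Fin (suc L) → Fin t) λ h → Injective _≡_ _≡_ h × (∀ j → c (h j) ≡ y)
  split (yes L<∣Z∣) = zero , embed Z L<∣Z∣ , embed-injective Z L<∣Z∣ ,
                      ∈-filter⁻ Z? ∘ embed-∈ Z L<∣Z∣
  split (no L≮∣Z∣)
    with y , h , h-injective , h-colour ←
      pigeonhole L (punchOut ∘ zero≢) (L*q<∣Z′∣ (ℕ.≤-pred (ℕ.≰⇒> L≮∣Z∣)))
    = suc y , enumerate Z′ ∘ h , h-injective ∘ enumerate-injective Z′ ,
      λ j → ≡.trans (≡.sym (punchIn-punchOut (zero≢ (h j)))) (cong suc (h-colour j))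

pigeonhole-⊆ : ∀ L (W : Subset n) (c : Fin t → Fin n) → (∀ j → c j ∈ W) → L * ∣ W ∣ < t →
  ∃[ w ] (w ∈ W × Σ (Fin (suc L) → Fin t) λ h →
            Injective _≡_ _≡_ h × (∀ j → c (h j) ≡ w))
pigeonhole-⊆ {t = t} L W c c∈W L*∣W∣<t =
  let y , h , h-injective , h-colour = pigeonhole L index L*∣W∣<t
  in enumerate W y , enumerate-∈ W y , h , h-injective ,
     λ j → ≡.trans (≡.sym (enumerate-index (h j))) (cong (enumerate W) (h-colour j))
  where
  index : Fin t → Fin ∣ W ∣
  index j = proj₁ (enumerate-surjective W (c∈W j))
  enumerate-index : ∀ j → enumerate W (index j) ≡ c j
  enumerate-index j = proj₂ (enumerate-surjective W (c∈W j))

induced : Graph n → (Fin s → Fin n) → Graph s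
induced G e = record
  { Adj    = λ i j → Adj G (e i) (e j)
  ; sym    = sym G
  ; irrefl = irrefl G
  ; adj?   = λ i j → adj? G (e i) (e j)
  }

Covers : Graph n → Fin n → Fin n → Set
Covers G u x = u ≡ x ⊎ Adj G u x

nonadjacent-everywhere : (G : Graph n) (e : Fin s → Fin n) →
  (∀ i j → i ≢ j → ¬ Adj G (e i) (e j)) → ∀ i j → ¬ Adj G (e i) (e j)
nonadjacent-everywhere G e independent i j with i ≟ j
... | yes refl = irrefl G
... | no  i≢j  = independent i j i≢j

image-independent : (G : Graph n) (e : Fin s → Fin n) →
  (∀ i j → i ≢ j → ¬ Adj G (e i) (e j)) → IndependentSet G (image e)
image-independent G e independent _ _ x∈ y∈
  with i , refl ← ∈-image⁻ e x∈ | j , refl ← ∈-image⁻ e y∈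
  = nonadjacent-everywhere G e independent i j

shared-dominator : ∀ L {G : Graph n} (W : Subset n) (v : Fin t → Fin n) →
  Dominates G W (image v) → L * ∣ W ∣ < t →
  ∃[ w ] (w ∈ W × Σ (Fin (suc L) → Fin t) λ h →
            Injective _≡_ _≡_ h × ∀ i → Covers G w (v (h i)))
shared-dominator L {G} W v dominates L*∣W∣<t =
  let w , w∈W , h , h-injective , h-dominator =
        pigeonhole-⊆ L W (proj₁ ∘ dominated) (proj₁ ∘ proj₂ ∘ dominated) L*∣W∣<t
  in w , w∈W , h , h-injective ,
     λ i → subst (λ u → Covers G u (v (h i))) (h-dominator i) (proj₂ (proj₂ (dominated (h i))))
  where
  dominated : ∀ j → ∃[ u ] (u ∈ W × Covers G u (v j))
  dominated j = dominates (v j) (∈-image v j)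

walk? : (G : Graph n) (a v : Fin n) (d : ℕ) → Dec (Walk G a v d)
walk? G a v zero with v ≟ a
... | yes refl = yes here
... | no  v≢a  = no λ { here → v≢a refl }
walk? G a v (suc d) with any? (λ u → walk? G a u d ×-dec adj? G u v)
... | yes (u , w , adj) = yes (step w adj)
... | no  ¬walk         = no λ { (step w adj) → ¬walk (_ , w , adj) }

module _ {G : Graph n} {a : Fin n} where

  AtDist-unique : ∀ {v d d′} → AtDist G a v d → AtDist G a v d′ → d ≡ d′
  AtDist-unique {d = d} {d′} (w , shortest) (w′ , shortest′) with ℕ.<-cmp d d′
  ... | tri< d<d′ _ _ = ⊥-elim (shortest′ d d<d′ w)
  ... | tri≈ _ d≡d′ _ = d≡d′
  ... | tri> _ _ d>d′ = ⊥-elim (shortest d′ d>d′ w′)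

  AtDist-<⇒≢ : ∀ {u v d d′} → AtDist G a u d → AtDist G a v d′ → d < d′ → u ≢ v
  AtDist-<⇒≢ du dv d<d′ refl = ℕ.<⇒≢ d<d′ (AtDist-unique du dv)

  ¬Adj-far : ∀ {u v d d′} → Walk G a u d → AtDist G a v d′ → suc d < d′ → ¬ Adj G u v
  ¬Adj-far w (_ , shortest) d<d′ adj = shortest _ d<d′ (step w adj)

  covers-deeper⇒Adj : ∀ {u v d} → AtDist G a u d → AtDist G a v (suc d) → Covers G u v → Adj G u v
  covers-deeper⇒Adj du dv (inj₁ u≡v) = ⊥-elim (AtDist-<⇒≢ du dv (ℕ.n<1+n _) u≡v)
  covers-deeper⇒Adj du dv (inj₂ adj) = adj

  AtDist-predecessor : ∀ {u v d} → Walk G a u d → Adj G u v → AtDist G a v (suc d) → AtDist G a u d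
  AtDist-predecessor w adj (_ , shortest) = w , λ j j<d wj → shortest (suc j) (s≤s j<d) (step wj adj)

module _ (G : Graph n) (X : Subset n) where

  covered? : (U : Subset n) (x : Fin n) → Dec (x ∈ X → ∃[ u ] (u ∈ U × Covers G u x))
  covered? U x = x ∈? X →-dec any? λ u → u ∈? U ×-dec (u ≟ x ⊎-dec adj? G u x)

  MinimalDominating : Subset n → Set
  MinimalDominating U = Dominates G U X × (∀ u → u ∈ U → ¬ Dominates G (U - u) X)

  minimal-dominating-⊆ : ∀ {U₀} → Dominates G U₀ X → ∃[ U ] (U ⊆ U₀ × MinimalDominating U)
  minimal-dominating-⊆ = shrink (⊂-wellFounded _)
    where
    shrink : ∀ {U₀} → Acc _⊂_ U₀ → Dominates G U₀ X →
      ∃[ U ] (U ⊆ U₀ × MinimalDominating U)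
    shrink {U₀} (acc smaller) dominates
      with any? (λ u → u ∈? U₀ ×-dec all? (covered? (U₀ - u)))
    ... | no irredundant =
      U₀ , (λ u∈ → u∈) , dominates , λ u u∈ dominates′ → irredundant (u , u∈ , dominates′)
    ... | yes (u , u∈ , dominates′)
      with U , U⊆ , minimal ← shrink (smaller (x∈p⇒p-x⊂p u∈)) dominates′
      = U , p─q⊆p U₀ ⁅ u ⁆ ∘ U⊆ , minimal

  private-neighbour : ∀ {U u} → MinimalDominating U → u ∈ U →
    ∃[ x ] (x ∈ X × Covers G u x × ∀ u′ → u′ ∈ U → Covers G u′ x → u′ ≡ u)
  private-neighbour {U} {u} (dominates , minimal) u∈U
    with x , undominated ← ¬∀⟶∃¬ n _ (covered? (U - u)) (minimal u u∈U)
    with x ∈? X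
  ... | no x∉X  = ⊥-elim (undominated (⊥-elim ∘ x∉X))
  ... | yes x∈X = x , x∈X , u-covers , unique
    where
    unique : ∀ u′ → u′ ∈ U → Covers G u′ x → u′ ≡ u
    unique u′ u′∈U covers with u′ ≟ u
    ... | yes u′≡u = u′≡u
    ... | no  u′≢u = ⊥-elim (undominated λ _ → u′ , x∈p∧x≢y⇒x∈p-y u′∈U u′≢u , covers)
    u-covers : Covers G u x
    u-covers with u′ , u′∈U , covers ← dominates x x∈X
      = subst (λ v → Covers G v x) (unique u′ u′∈U covers) covers

record PrivateDominatingSet (G : Graph n) (a : Fin n) (X : Subset n) (d : ℕ) : Set where
  field
    U            : Subset n
    U-dist       : ∀ u → u ∈ U → AtDist G a u d
    U-dominates  : Dominates G U X
    private-leaf : ∀ u → u ∈ U →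
      ∃[ x ] (x ∈ X × Adj G u x × ∀ u′ → u′ ∈ U → Adj G u′ x → u′ ≡ u)

private-dominating-set : (G : Graph n) (a : Fin n) (d : ℕ) (X : Subset n) →
  (∀ v → v ∈ X → AtDist G a v (suc d)) → PrivateDominatingSet G a X d
private-dominating-set {n} G a d X dist-X = record
  { U            = U
  ; U-dist       = λ u u∈U → let x , x∈X , adj , _ = private-leaf u u∈U
                             in AtDist-predecessor (walk u∈U) adj (dist-X x x∈X)
  ; U-dominates  = proj₁ minimal
  ; private-leaf = private-leaf
  }
  where
  U₀ : Subset n
  U₀ = filter (λ v → walk? G a v d)

  U₀-dominates : Dominates G U₀ X
  U₀-dominates x x∈X with step {v} w adj ← proj₁ (dist-X x x∈X)
    = v , ∈-filter⁺ (λ v → walk? G a v d) w , inj₂ adj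

  shrunk : ∃[ U ] (U ⊆ U₀ × MinimalDominating G X U)
  shrunk = minimal-dominating-⊆ G X U₀-dominates

  U : Subset n
  U = proj₁ shrunk

  minimal : MinimalDominating G X U
  minimal = proj₂ (proj₂ shrunk)

  walk : ∀ {u} → u ∈ U → Walk G a u d
  walk u∈U = ∈-filter⁻ (λ v → walk? G a v d) (proj₁ (proj₂ shrunk) u∈U)

  private-leaf : ∀ u → u ∈ U →
    ∃[ x ] (x ∈ X × Adj G u x × ∀ u′ → u′ ∈ U → Adj G u′ x → u′ ≡ u)
  private-leaf u u∈U with x , x∈X , covers , unique ← private-neighbour G X minimal u∈U
    with covers
  ... | inj₁ refl = ⊥-elim (proj₂ (dist-X x x∈X) d (ℕ.n<1+n d) (walk u∈U))
  ... | inj₂ adj  = x , x∈X , adj , λ u′ u′∈U adj′ → unique u′ u′∈U (inj₂ adj′)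

record InducedMatching (G : Graph n) (s : ℕ) : Set where
  field
    stem leaf          : Fin s → Fin n
    stem-injective     : Injective _≡_ _≡_ stem
    stem≢leaf          : ∀ i j → stem i ≢ leaf j
    stem-leaf          : ∀ i → Adj G (stem i) (leaf i)
    stem-leaf⁻¹        : ∀ {i j} → Adj G (stem i) (leaf j) → i ≡ j
    leaves-independent : ∀ i j → ¬ Adj G (leaf i) (leaf j)

  vertex : Fin s ⊎ Fin s → Fin n
  vertex = [ stem , leaf ]′

  vertex-injective : Injective _≡_ _≡_ vertex
  vertex-injective {inj₁ i} {inj₁ j} eq = cong inj₁ (stem-injective eq)
  vertex-injective {inj₁ i} {inj₂ j} eq = ⊥-elim (stem≢leaf i j eq)
  vertex-injective {inj₂ i} {inj₁ j} eq = ⊥-elim (stem≢leaf j i (≡.sym eq))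
  vertex-injective {inj₂ i} {inj₂ j} eq =
    cong inj₂ (stem-leaf⁻¹ (subst (Adj G (stem i)) eq (stem-leaf i)))

  stem-leaf-adjacency : ∀ i j →
    (Adj G (stem i) (leaf j) → i ≡ j) × (i ≡ j → Adj G (stem i) (leaf j))
  stem-leaf-adjacency i j = stem-leaf⁻¹ , λ { refl → stem-leaf i }

  leaf-stem-adjacency : ∀ i j →
    (Adj G (leaf i) (stem j) → i ≡ j) × (i ≡ j → Adj G (leaf i) (stem j))
  leaf-stem-adjacency i j =
    (λ adj → ≡.sym (stem-leaf⁻¹ (sym G adj))) , λ { refl → sym G (stem-leaf i) }

restrict : {G : Graph n} → InducedMatching G s → (f : Fin r → Fin s) → Injective _≡_ _≡_ f →
  InducedMatching G r
restrict M f f-injective = record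
  { stem               = stem ∘ f
  ; leaf               = leaf ∘ f
  ; stem-injective     = f-injective ∘ stem-injective
  ; stem≢leaf          = λ i j → stem≢leaf (f i) (f j)
  ; stem-leaf          = stem-leaf ∘ f
  ; stem-leaf⁻¹        = f-injective ∘ stem-leaf⁻¹
  ; leaves-independent = λ i j → leaves-independent (f i) (f j)
  }
  where open InducedMatching M

module _ {G : Graph n} where

  K*-induced : ∀ {k} (M : InducedMatching G k) → let open InducedMatching M in
    (∀ i j → i ≢ j → Adj G (stem i) (stem j)) → ContainsInduced G (Fin k ⊎ Fin k) (KStarAdj k)
  K*-induced M clique = vertex , vertex-injective , adjacency
    where
    open InducedMatching M
    adjacency : ∀ u v → (Adj G (vertex u) (vertex v) → KStarAdj _ u v) ×
                        (KStarAdj _ u v → Adj G (vertex u) (vertex v))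
    adjacency (inj₁ i) (inj₁ j) = (λ { adj refl → irrefl G adj }) , clique i j
    adjacency (inj₁ i) (inj₂ j) = stem-leaf-adjacency i j
    adjacency (inj₂ i) (inj₁ j) = leaf-stem-adjacency i j
    adjacency (inj₂ i) (inj₂ j) = leaves-independent i j , λ ()

  S*-induced : ∀ {ℓ} (M : InducedMatching G ℓ) (w : Fin n) → let open InducedMatching M in
    (∀ i → Adj G w (stem i)) → (∀ i → ¬ Adj G w (leaf i)) → (∀ i → w ≢ leaf i) →
    (∀ i j → ¬ Adj G (stem i) (stem j)) → ContainsInduced G (⊤ ⊎ (Fin ℓ ⊎ Fin ℓ)) (SStarAdj ℓ)
  S*-induced M w w-stem w-leaf w≢leaf stems-independent = ψ , ψ-injective , adjacency
    where
    open InducedMatching M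
    ψ : ⊤ ⊎ (Fin _ ⊎ Fin _) → Fin n
    ψ = [ (λ _ → w) , vertex ]′
    w≢vertex : ∀ v → w ≢ vertex v
    w≢vertex (inj₁ i) refl = irrefl G (w-stem i)
    w≢vertex (inj₂ i) = w≢leaf i
    ψ-injective : Injective _≡_ _≡_ ψ
    ψ-injective {inj₁ _} {inj₁ _} _  = refl
    ψ-injective {inj₁ _} {inj₂ v} eq = ⊥-elim (w≢vertex v eq)
    ψ-injective {inj₂ v} {inj₁ _} eq = ⊥-elim (w≢vertex v (≡.sym eq))
    ψ-injective {inj₂ u} {inj₂ v} eq = cong inj₂ (vertex-injective eq)
    adjacency : ∀ u v → (Adj G (ψ u) (ψ v) → SStarAdj _ u v) ×
                        (SStarAdj _ u v → Adj G (ψ u) (ψ v))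
    adjacency (inj₁ _)        (inj₁ _)        = irrefl G , λ ()
    adjacency (inj₁ _)        (inj₂ (inj₁ i)) = (λ _ → tt) , λ _ → w-stem i
    adjacency (inj₁ _)        (inj₂ (inj₂ i)) = w-leaf i , λ ()
    adjacency (inj₂ (inj₁ i)) (inj₁ _)        = (λ _ → tt) , λ _ → sym G (w-stem i)
    adjacency (inj₂ (inj₂ i)) (inj₁ _)        = w-leaf i ∘ sym G , λ ()
    adjacency (inj₂ (inj₁ i)) (inj₂ (inj₁ j)) = stems-independent i j , λ ()
    adjacency (inj₂ (inj₁ i)) (inj₂ (inj₂ j)) = stem-leaf-adjacency i j
    adjacency (inj₂ (inj₂ i)) (inj₂ (inj₁ j)) = leaf-stem-adjacency i j
    adjacency (inj₂ (inj₂ i)) (inj₂ (inj₂ j)) = leaves-independent i j , λ ()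

BoundedDomination : Graph n → Fin n → ℕ → ℕ → Set
BoundedDomination G a i m = ∀ X → IndependentSet G X → (∀ v → v ∈ X → AtDist G a v i) →
  ∃[ U ] (∣ U ∣ ≤ m × (∀ u → u ∈ U → AtDist G a u (i ∸ 1)) × Dominates G U X)

domination-at-distance-one : (G : Graph n) (a : Fin n) → BoundedDomination G a 1 1
domination-at-distance-one G a X _ dist-X = ⁅ a ⁆ , ℕ.≤-reflexive (∣⁅x⁆∣≡1 a) , at-a , dominates
  where
  at-a : ∀ u → u ∈ ⁅ a ⁆ → AtDist G a u 0
  at-a u u∈ rewrite x∈⁅y⁆⇒x≡y a u∈ = here , λ _ ()
  dominates : Dominates G ⁅ a ⁆ X
  dominates x x∈X with step here adj ← proj₁ (dist-X x x∈X) = a , x∈⁅x⁆ a , inj₂ adj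

module _ (k L : ℕ) {n} (G : Graph n) (K*-free : KStarFree G k) (S*-free : SStarFree G (suc L))
  (a : Fin n) where

  module LargePrivateDominatingSet {d : ℕ} {X : Subset n} (X-independent : IndependentSet G X)
    (dist-X : ∀ v → v ∈ X → AtDist G a v (suc (suc d)))
    (P : PrivateDominatingSet G a X (suc d)) {r : ℕ} (r≤∣U∣ : r ≤ ∣ PrivateDominatingSet.U P ∣)
    where

    open PrivateDominatingSet P

    stem : Fin r → Fin n
    stem = embed U r≤∣U∣

    stem-∈ : ∀ j → stem j ∈ U
    stem-∈ = embed-∈ U r≤∣U∣

    stem-dist : ∀ j → AtDist G a (stem j) (suc d)
    stem-dist j = U-dist (stem j) (stem-∈ j)

    leaf-of-stem : ∀ j →
      ∃[ x ] (x ∈ X × Adj G (stem j) x × ∀ u → u ∈ U → Adj G u x → u ≡ stem j)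
    leaf-of-stem j = private-leaf (stem j) (stem-∈ j)

    leaf : Fin r → Fin n
    leaf = proj₁ ∘ leaf-of-stem

    leaf-∈ : ∀ j → leaf j ∈ X
    leaf-∈ = proj₁ ∘ proj₂ ∘ leaf-of-stem

    leaf-dist : ∀ j → AtDist G a (leaf j) (suc (suc d))
    leaf-dist j = dist-X (leaf j) (leaf-∈ j)

    matching : InducedMatching G r
    matching = record
      { stem               = stem
      ; leaf               = leaf
      ; stem-injective     = embed-injective U r≤∣U∣
      ; stem≢leaf          = λ i j → AtDist-<⇒≢ (stem-dist i) (leaf-dist j) (ℕ.n<1+n _)
      ; stem-leaf          = proj₁ ∘ proj₂ ∘ proj₂ ∘ leaf-of-stem
      ; stem-leaf⁻¹        = λ {i} {j} adj →
          embed-injective U r≤∣U∣ (proj₂ (proj₂ (proj₂ (leaf-of-stem j))) (stem i) (stem-∈ i) adj)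
      ; leaves-independent = λ i j → X-independent (leaf i) (leaf j) (leaf-∈ i) (leaf-∈ j)
      }

    no-clique : ¬ HasClique (induced G stem) k
    no-clique (f , f-injective , clique) = K*-free (K*-induced (restrict matching f f-injective) clique)

    no-independent-set : ∀ {m} → BoundedDomination G a (suc d) m →
      ¬ HasIndep (induced G stem) (L * m + 1)
    no-independent-set {m} IH (f , f-injective , independent) =
      let W , ∣W∣≤m , W-dist , W-dominates = IH (image v) (image-independent G v independent) image-dist
          w , w∈W , h , h-injective , w-covers =
            shared-dominator L {G} W v W-dominates
              (ℕ.≤-<-trans (ℕ.*-monoʳ-≤ L ∣W∣≤m) (ℕ.m<m+n (L * m) z<s))
          w-dist = W-dist w w∈W
      in S*-free (S*-induced (restrict matching (f ∘ h) (h-injective ∘ f-injective)) w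
           (λ i → covers-deeper⇒Adj w-dist (stem-dist (f (h i))) (w-covers i))
           (λ i → ¬Adj-far (proj₁ w-dist) (leaf-dist (f (h i))) (ℕ.n<1+n _))
           (λ i → AtDist-<⇒≢ w-dist (leaf-dist (f (h i))) (ℕ.m<n⇒m<1+n (ℕ.n<1+n d)))
           (nonadjacent-everywhere G (v ∘ h)
              λ i j i≢j → independent (h i) (h j) (i≢j ∘ h-injective)))
      where
      v : Fin (L * m + 1) → Fin n
      v = stem ∘ f
      image-dist : ∀ x → x ∈ image v → AtDist G a x (suc d)
      image-dist x x∈ with j , refl ← ∈-image⁻ v x∈ = stem-dist (f j)

  ramsey-step : ∀ {d m r} → BoundedDomination G a (suc d) m → RamseyProp k (L * m + 1) r →
    BoundedDomination G a (suc (suc d)) (r ∸ 1)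
  ramsey-step {d} {m} {r} IH ramsey X X-independent dist-X = U , ∣U∣≤r∸1 , U-dist , U-dominates
    where
    P : PrivateDominatingSet G a X (suc d)
    P = private-dominating-set G a (suc d) X dist-X
    open PrivateDominatingSet P
    ∣U∣≤r∸1 : ∣ U ∣ ≤ r ∸ 1
    ∣U∣≤r∸1 with ∣ U ∣ ≤? r ∸ 1
    ... | yes ∣U∣≤r∸1 = ∣U∣≤r∸1
    ... | no  ∣U∣≰r∸1 = ⊥-elim ([ no-clique , no-independent-set IH ]′ (ramsey (induced G stem)))
      where
      r≤∣U∣ : r ≤ ∣ U ∣
      r≤∣U∣ = ℕ.≤-trans (ℕ.m≤n+m∸n r 1) (ℕ.≰⇒> ∣U∣≰r∸1)
      open LargePrivateDominatingSet X-independent dist-X P r≤∣U∣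

  bounded-domination : ∀ {i m} → IsG k (suc L) i m → BoundedDomination G a i m
  bounded-domination g-one = domination-at-distance-one G a
  bounded-domination (g-step {i = suc d} g ramsey) = ramsey-step (bounded-domination g) (proj₁ ramsey)

lemma1 : (k ℓ i : ℕ) → 1 ≤ k → 1 ≤ ℓ → 1 ≤ i →
    ∀ {n} (G : Graph n) → KStarFree G k → SStarFree G ℓ →
    (a : Fin n) (X : Subset n) → IndependentSet G X →
    (∀ v → v ∈ X → AtDist G a v i) →
    (m : ℕ) → IsG k ℓ i m →
    ∃[ U ] (∣ U ∣ ≤ m × (∀ u → u ∈ U → AtDist G a u (i ∸ 1)) × Dominates G U X)
lemma1 k zero    i _ () _ _ _ _ _ _ _ _ _ _
lemma1 k (suc L) i _ _ _ G K*-free S*-free a X X-independent dist-X m g =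
  bounded-domination k L G K*-free S*-free a g X X-independent dist-X
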